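{- Every finite strongly connected digraph $D$ with even period has idomatic number $id(D)\ge 2$, i.e. $D$ contains two vertex-disjoint independent dominating sets.
   Context: Digraphs may contain antiparallel arcs. The period of a digraph is the greatest common divisor of the lengths of all directed cycles it contains. In a digraph $D=(V,A)$, a set $S\subseteq V$ is independent if there are no $u,v\in S$ with $(u,v)\in A$; $S$ is dominating if every vertex of $V\setminus S$ has an in-neighbour in $S$; an independent dominating set is a set that is both. The idomatic number $id(D)$ is the maximum number of pairwise vertex-disjoint independent dominating sets of $D$. -}

module Defs where

open import Data.Nat using (ℕ; zero; suc)
open import Data.Nat.Divisibility using (_∣_)
open import Data.Fin using (Fin; zero; suc; inject₁; fromℕ)
open import Data.Fin.Subset using (Subset; _∈_; _∉_)
open import Data.Empty using (⊥)
open import Data.Product using (Σ; ∃; _×_)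
open import Relation.Nullary using (¬_)
open import Function.Definitions using (Injective)
open import Relation.Binary.PropositionalEquality using (_≡_)
open import Relation.Binary.Construct.Closure.ReflexiveTransitive using (Star)

-- A finite digraph on vertex set Fin n, given by its arc relation
-- (antiparallel arcs u→v and v→u are allowed).
Digraph : ℕ → Set₁
Digraph n = Fin n → Fin n → Set

-- A directed cycle of length (suc m): distinct vertices c 0, …, c m with
-- arcs c i → c (i+1) and c m → c 0.
record Cycle {n : ℕ} (D : Digraph n) (m : ℕ) : Set where
  field
    vtx    : Fin (suc m) → Fin n
    distinct : Injective _≡_ _≡_ vtx
    step   : (i : Fin m) → D (vtx (inject₁ i)) (vtx (suc i))
    close  : D (vtx (fromℕ m)) (vtx zero)

HasCycleOfLength : {n : ℕ} → Digraph n → ℕ → Set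
HasCycleOfLength D zero = ⊥
HasCycleOfLength D (suc m) = Cycle D m

HasCycle : {n : ℕ} → Digraph n → Set
HasCycle D = ∃ λ len → HasCycleOfLength D len

-- p is the period: the gcd of the lengths of all directed cycles
-- (characterised as the greatest common divisor w.r.t. divisibility).
IsPeriod : {n : ℕ} → Digraph n → ℕ → Set
IsPeriod D p =
  ((len : ℕ) → HasCycleOfLength D len → p ∣ len) ×
  ((q : ℕ) → ((len : ℕ) → HasCycleOfLength D len → q ∣ len) → q ∣ p)

StronglyConnected : {n : ℕ} → Digraph n → Set
StronglyConnected D = ∀ u v → Star D u v

Independent : {n : ℕ} → Digraph n → Subset n → Set
Independent D S = ∀ u v → u ∈ S → v ∈ S → ¬ D u v

Dominating : {n : ℕ} → Digraph n → Subset n → Set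
Dominating D S = ∀ v → v ∉ S → ∃ λ u → u ∈ S × D u v

IndependentDominating : {n : ℕ} → Digraph n → Subset n → Set
IndependentDominating D S = Independent D S × Dominating D S

Disjoint : {n : ℕ} → Subset n → Subset n → Set
Disjoint S T = ∀ v → v ∈ S → v ∈ T → ⊥

IdomaticAtLeast2 : {n : ℕ} → Digraph n → Set
IdomaticAtLeast2 D =
  ∃ λ S → ∃ λ T →
    IndependentDominating D S × IndependentDominating D T × Disjoint S T

-- Removing the cycles closed at repeated vertices turns any closed walk into
-- the empty one, so the period divides the length of every closed walk; as it
-- is even, all closed walks are even. In a strongly connected digraph all walks
-- from a fixed root to v therefore have the same length parity, and every arc
-- changes that parity. The two parity classes are independent, and each of them
-- dominates the other, because every vertex has an in-neighbour and that
-- in-neighbour lies in the opposite class.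
module Submission where

open import Data.Nat using (ℕ; zero; suc; _+_; parity)
open import Data.Nat.Divisibility using (_∣_; divides; ∣-trans; ∣m∣n⇒∣m+n; _∣0)
open import Data.Nat.Tactic.RingSolver using (solve-∀)
open import Data.Parity.Base as ℙ using (Parity; 0ℙ; 1ℙ; _⁻¹)
open import Data.Parity.Properties using (_≟_; p≢p⁻¹; +-comm; +-cancelʳ-≡; *-zeroʳ; +-homo-+; *-homo-*)
open import Data.Fin using (Fin; zero; suc; inject₁; fromℕ)
import Data.Fin.Properties as Fin
open import Data.Fin.Subset using (Subset; _∈_)
open import Data.Vec using (tabulate)
open import Data.Vec.Properties using (lookup∘tabulate; []=⇒lookup; lookup⇒[]=)
open import Data.List using (List; []; _∷_; _++_)
open import Data.List.Relation.Unary.Any using (here; there; any?)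
open import Data.List.Relation.Unary.All as All using ([]; _∷_)
open import Data.List.Relation.Unary.All.Properties using (¬Any⇒All¬; ++⁻ˡ; ++⁻ʳ)
open import Data.List.Relation.Unary.AllPairs using ([]; _∷_)
open import Data.List.Relation.Unary.Unique.Propositional using (Unique)
open import Data.List.Membership.Propositional using () renaming (_∈_ to _∈ₗ_; _∉_ to _∉ₗ_)
open import Data.Product using (∃; ∃₂; _×_; _,_)
open import Data.Empty using (⊥-elim)
open import Relation.Nullary using (yes; no; does)
open import Relation.Nullary.Decidable using (dec-true)
open import Relation.Binary.PropositionalEquality
open import Relation.Binary.Construct.Closure.ReflexiveTransitive using (Star; ε; _◅_; _◅◅_)
open import Defs

private
  variable
    n : ℕ

Unique-++⁻ : {A : Set} (xs : List A) {ys : List A} → Unique (xs ++ ys) →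
             Unique xs × Unique ys × (∀ {z} → z ∈ₗ xs → z ∉ₗ ys)
Unique-++⁻ []       ys! = [] , ys! , λ ()
Unique-++⁻ (x ∷ xs) (x∉ ∷ xs++ys!) with Unique-++⁻ xs xs++ys!
... | xs! , ys! , disjoint = ++⁻ˡ xs x∉ ∷ xs! , ys! , λ
  { (here refl) z∈ys → All.lookup (++⁻ʳ xs x∉) z∈ys refl
  ; (there z∈xs) → disjoint z∈xs }

parity-even : ∀ {m} → 2 ∣ m → parity m ≡ 0ℙ
parity-even (divides q refl) = trans (*-homo-* q 2) (*-zeroʳ (parity q))

p≢q⇒p⁻¹≡q : ∀ {p q} → p ≢ q → p ⁻¹ ≡ q
p≢q⇒p⁻¹≡q {0ℙ} {0ℙ} p≢q = ⊥-elim (p≢q refl)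
p≢q⇒p⁻¹≡q {0ℙ} {1ℙ} _   = refl
p≢q⇒p⁻¹≡q {1ℙ} {0ℙ} _   = refl
p≢q⇒p⁻¹≡q {1ℙ} {1ℙ} p≢q = ⊥-elim (p≢q refl)

module _ {D : Digraph n} where

  length : ∀ {x y} → Star D x y → ℕ
  length ε       = 0
  length (_ ◅ w) = suc (length w)

  length-◅◅ : ∀ {x y z} (w : Star D x y) (v : Star D y z) →
              length (w ◅◅ v) ≡ length w + length v
  length-◅◅ ε       v = refl
  length-◅◅ (_ ◅ w) v = cong suc (length-◅◅ w v)

  sources : ∀ {x y} → Star D x y → List (Fin n)
  sources ε           = []
  sources {x} (_ ◅ w) = x ∷ sources w

  vertices targets : ∀ {x y} → Star D x y → List (Fin n)
  vertices {x} w = x ∷ targets w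
  targets ε       = []
  targets (_ ◅ w) = vertices w

  vertices-◅◅ : ∀ {x y z} (w : Star D x y) (v : Star D y z) →
                vertices (w ◅◅ v) ≡ sources w ++ vertices v
  vertices-◅◅ ε       v = refl
  vertices-◅◅ (_ ◅ w) v = cong (_ ∷_) (vertices-◅◅ w v)

  last∈vertices : ∀ {x y} (w : Star D x y) → y ∈ₗ vertices w
  last∈vertices ε       = here refl
  last∈vertices (_ ◅ w) = there (last∈vertices w)

  splitAt : ∀ {x y z} (w : Star D x y) → z ∈ₗ vertices w →
            ∃₂ λ (u : Star D x z) (v : Star D z y) → w ≡ u ◅◅ v
  splitAt w       (here refl) = ε , w , refl
  splitAt (a ◅ w) (there z∈w) with splitAt w z∈w
  ... | u , v , refl = a ◅ u , v , refl

  vertexAt : ∀ {x y} (w : Star D x y) → Fin (suc (length w)) → Fin n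
  vertexAt {x} w zero    = x
  vertexAt (_ ◅ w) (suc i) = vertexAt w i

  arcAt : ∀ {x y} (w : Star D x y) (i : Fin (length w)) →
          D (vertexAt w (inject₁ i)) (vertexAt w (suc i))
  arcAt (a ◅ w) zero    = a
  arcAt (_ ◅ w) (suc i) = arcAt w i

  vertexAt-last : ∀ {x y} (w : Star D x y) → vertexAt w (fromℕ (length w)) ≡ y
  vertexAt-last ε       = refl
  vertexAt-last (_ ◅ w) = vertexAt-last w

  vertexAt∈sources : ∀ {x y} (w : Star D x y) (i : Fin (length w)) →
                     vertexAt w (inject₁ i) ∈ₗ sources w
  vertexAt∈sources (_ ◅ w) zero    = here refl
  vertexAt∈sources (_ ◅ w) (suc i) = there (vertexAt∈sources w i)

  vertexAt-injective : ∀ {x y} (w : Star D x y) → Unique (sources w) →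
                       ∀ {i j} → vertexAt w (inject₁ i) ≡ vertexAt w (inject₁ j) → i ≡ j
  vertexAt-injective (_ ◅ w) _         {zero}  {zero}  _ = refl
  vertexAt-injective (_ ◅ w) (x∉ ∷ _)  {zero}  {suc j} e =
    ⊥-elim (All.lookup x∉ (vertexAt∈sources w j) e)
  vertexAt-injective (_ ◅ w) (x∉ ∷ _)  {suc i} {zero}  e =
    ⊥-elim (All.lookup x∉ (vertexAt∈sources w i) (sym e))
  vertexAt-injective (_ ◅ w) (_ ∷ w!)  {suc i} {suc j} e =
    cong suc (vertexAt-injective w w! e)

  simpleClosedWalk⇒cycle : ∀ {x z} (a : D x z) (w : Star D z x) →
                           Unique (sources (a ◅ w)) → HasCycleOfLength D (length (a ◅ w))
  simpleClosedWalk⇒cycle a w simple = record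
    { vtx      = λ i → vertexAt (a ◅ w) (inject₁ i)
    ; distinct = vertexAt-injective (a ◅ w) simple
    ; step     = λ i → arcAt (a ◅ w) (inject₁ i)
    ; close    = subst (D _) (vertexAt-last w) (arcAt (a ◅ w) (fromℕ (length w)))
    }

  inNeighbour : ∀ {u x v} → D u x → Star D x v → ∃ λ w → D w v
  inNeighbour a ε       = _ , a
  inNeighbour _ (b ◅ w) = inNeighbour b w

suc-+-rearrange : ∀ a b c → suc (a + b + c) ≡ b + (suc a + c)
suc-+-rearrange = solve-∀

module _ {D : Digraph n} {d : ℕ}
         (d∣cycles : ∀ len → HasCycleOfLength D len → d ∣ len) where

  record Shortcut {x y} (w : Star D x y) : Set where
    constructor shortcut
    field
      path     : Star D x y
      simple   : Unique (vertices path)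
      excess   : ℕ
      d∣excess : d ∣ excess
      length≡  : length w ≡ length path + excess

  shortcutOf : ∀ {x y} (w : Star D x y) → Shortcut w
  shortcutOf ε = shortcut ε ([] ∷ []) 0 (d ∣0) refl
  shortcutOf {x} (a ◅ w) with shortcutOf w
  ... | shortcut p p! k d∣k eq with any? (x Fin.≟_) (vertices p)
  ...   | no x∉p = shortcut (a ◅ p) (¬Any⇒All¬ _ x∉p ∷ p!) k d∣k (cong suc eq)
  -- x reappears on p: the prefix of p up to x closes the cycle a ◅ q₁, which is cut out.
  ...   | yes x∈p with splitAt p x∈p
  ...     | q₁ , q₂ , refl
    with Unique-++⁻ (sources q₁) (subst Unique (vertices-◅◅ q₁ q₂) p!)
  ...       | q₁! , q₂! , disjoint =
    shortcut q₂ q₂! (suc (length q₁) + k) (∣m∣n⇒∣m+n (d∣cycles _ cycle) d∣k) lengths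
    where
    open ≡-Reasoning
    cycle : HasCycleOfLength D (length (a ◅ q₁))
    cycle = simpleClosedWalk⇒cycle a q₁
      (¬Any⇒All¬ _ (λ x∈q₁ → disjoint x∈q₁ (here refl)) ∷ q₁!)
    lengths : suc (length w) ≡ length q₂ + (suc (length q₁) + k)
    lengths = begin
      suc (length w)                     ≡⟨ cong suc eq ⟩
      suc (length (q₁ ◅◅ q₂) + k)        ≡⟨ cong (λ m → suc (m + k)) (length-◅◅ q₁ q₂) ⟩
      suc (length q₁ + length q₂ + k)    ≡⟨ suc-+-rearrange (length q₁) (length q₂) k ⟩
      length q₂ + (suc (length q₁) + k)  ∎

  closedWalk-length-divisible : ∀ {x} (w : Star D x x) → d ∣ length w
  closedWalk-length-divisible w with shortcutOf w
  ... | shortcut ε       _        k d∣k eq = subst (d ∣_) (sym eq) d∣k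
  ... | shortcut (_ ◅ p) (x∉ ∷ _) _ _   _  = ⊥-elim (All.lookup x∉ (last∈vertices p) refl)

module _ {D : Digraph n}
         (closedEven : ∀ {x} (w : Star D x x) → parity (length w) ≡ 0ℙ) where

  walkParity-unique : ∀ {x y} → Star D y x → (w w′ : Star D x y) →
                      parity (length w) ≡ parity (length w′)
  walkParity-unique back w w′ =
    +-cancelʳ-≡ (parity (length back)) _ _ (trans (closed w) (sym (closed w′)))
    where
    open ≡-Reasoning
    closed : ∀ v → parity (length v) ℙ.+ parity (length back) ≡ 0ℙ
    closed v = begin
      parity (length v) ℙ.+ parity (length back) ≡⟨ +-homo-+ (length v) (length back) ⟨
      parity (length v + length back)            ≡⟨ cong parity (length-◅◅ v back) ⟨
      parity (length (v ◅◅ back))                ≡⟨ closedEven (v ◅◅ back) ⟩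
      0ℙ                                         ∎

  parityFrom : StronglyConnected D → Fin n → Fin n → Parity
  parityFrom sc root v = parity (length (sc root v))

  parityFrom-flips : (sc : StronglyConnected D) (root : Fin n) → ∀ {u v} → D u v →
                     parityFrom sc root v ≡ parityFrom sc root u ⁻¹
  parityFrom-flips sc root {u} {v} a = begin
    parity (length (sc root v))             ≡⟨ walkParity-unique (sc v root) (sc root v) (sc root u ◅◅ a ◅ ε) ⟩
    parity (length (sc root u ◅◅ a ◅ ε))    ≡⟨ cong parity (length-◅◅ (sc root u) (a ◅ ε)) ⟩
    parity (length (sc root u) + 1)         ≡⟨ +-homo-+ (length (sc root u)) 1 ⟩
    parity (length (sc root u)) ℙ.+ 1ℙ      ≡⟨ +-comm _ 1ℙ ⟩
    parity (length (sc root u)) ⁻¹          ∎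
    where open ≡-Reasoning

module _ (colour : Fin n → Parity) where

  colourClass : Parity → Subset n
  colourClass p = tabulate (λ v → does (colour v ≟ p))

  ∈-colourClass⁺ : ∀ {v p} → colour v ≡ p → v ∈ colourClass p
  ∈-colourClass⁺ {v} {p} e =
    lookup⇒[]= v _ (trans (lookup∘tabulate _ v) (dec-true (colour v ≟ p) e))

  ∈-colourClass⁻ : ∀ {v p} → v ∈ colourClass p → colour v ≡ p
  ∈-colourClass⁻ {v} {p} v∈
    with colour v ≟ p | trans (sym (lookup∘tabulate _ v)) ([]=⇒lookup v∈)
  ... | yes e | _ = e
  ... | no _  | ()

  colourClass-disjoint : ∀ {p q} → p ≢ q → Disjoint (colourClass p) (colourClass q)
  colourClass-disjoint p≢q v v∈p v∈q =
    p≢q (trans (sym (∈-colourClass⁻ v∈p)) (∈-colourClass⁻ v∈q))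

  module _ {D : Digraph n} (flips : ∀ {u v} → D u v → colour v ≡ colour u ⁻¹) where

    colourClass-independent : ∀ p → Independent D (colourClass p)
    colourClass-independent p u v u∈ v∈ a = p≢p⁻¹ p (begin
      p           ≡⟨ ∈-colourClass⁻ v∈ ⟨
      colour v    ≡⟨ flips a ⟩
      colour u ⁻¹ ≡⟨ cong _⁻¹ (∈-colourClass⁻ u∈) ⟩
      p ⁻¹        ∎)
      where open ≡-Reasoning

    colourClass-dominating : (∀ v → ∃ λ u → D u v) → ∀ p → Dominating D (colourClass p)
    colourClass-dominating hasInNeighbour p v v∉ with hasInNeighbour v
    ... | u , a with colour u ≟ p
    ...   | yes e = u , ∈-colourClass⁺ e , a
    ...   | no ne = ⊥-elim (v∉ (∈-colourClass⁺ (trans (flips a) (p≢q⇒p⁻¹≡q ne))))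

mainTheorem6 : (n : ℕ) (D : Digraph n) → StronglyConnected D → HasCycle D →
    (p : ℕ) → IsPeriod D p → 2 ∣ p → IdomaticAtLeast2 D
mainTheorem6 n D sc (zero , ())
mainTheorem6 n D sc (suc _ , cycle) p (p∣cycles , _) 2∣p =
  colourClass colour 0ℙ , colourClass colour 1ℙ ,
  independentDominating 0ℙ , independentDominating 1ℙ ,
  colourClass-disjoint colour (λ ())
  where
  closedEven : ∀ {x} (w : Star D x x) → parity (length w) ≡ 0ℙ
  closedEven w = parity-even
    (closedWalk-length-divisible (λ len c → ∣-trans 2∣p (p∣cycles len c)) w)
  colour : Fin n → Parity
  colour = parityFrom closedEven sc (Cycle.vtx cycle zero)
  hasInNeighbour : ∀ v → ∃ λ u → D u v
  hasInNeighbour v = inNeighbour (Cycle.close cycle) (sc _ v)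
  independentDominating : ∀ q → IndependentDominating D (colourClass colour q)
  independentDominating q =
    colourClass-independent colour (parityFrom-flips closedEven sc _) q ,
    colourClass-dominating colour (parityFrom-flips closedEven sc _) hasInNeighbour q
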